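{- Let $j$ be a positive integer such that the fibbinary number $\mathrm{fib}(j)$ is odd, and suppose that $\mathrm{fib}(j)$ is the $n$th odd fibbinary number, i.e. $\mathrm{fib}(j)=\mathrm{odfib}(n)$, equivalently $j = Z(n)$. Then for every $n\ge 1$, $$ j = Z(n) = \left\lfloor n\phi^2\right\rfloor - 1 = \left\lfloor n\phi\right\rfloor + n - 1, $$ where $\phi = \frac{1+\sqrt5}{2}$ is the golden ratio.
   Context: The Fibonacci numbers are defined by $F_0=0$, $F_1=1$, $F_n=F_{n-1}+F_{n-2}$ for $n\ge 2$. By Zeckendorf's theorem every positive integer $m$ can be written uniquely as $m = F_{i_1}+F_{i_2}+\dots+F_{i_k}$ with $i_1>i_2>\dots>i_k\ge 2$ and $i_{t}-i_{t+1}\ge 2$ for all $t$ (the summand $1$ is always taken as $F_2$). The fibbinary function is $\mathrm{fib}(m) := \sum_{t=1}^k 2^{i_t-2}$; it is a strictly increasing bijection from the positive integers onto the positive integers whose binary representation contains no two consecutive ones (the "fibbinary numbers"). Let $\mathrm{odfib}(n)$ denote the $n$th odd fibbinary number in increasing order (so $\mathrm{odfib}(1)=1$, $\mathrm{odfib}(2)=5=101_2$, $\mathrm{odfib}(3)=9=1001_2,\dots$), and let $Z(n) := \mathrm{fib}^{ -1}(\mathrm{odfib}(n))$, so $Z(1)=1, Z(2)=4, Z(3)=6, Z(4)=9,\dots$. -}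

module Defs where

open import Data.Nat.Base
open import Data.Bool.Base using (Bool; true; false; not; _∧_; if_then_else_)
open import Data.List.Base using (List; filter; upTo; lookup; length)
open import Data.List.Base as L using ()
open import Data.Product.Base using (_×_)
open import Relation.Nullary.Decidable.Core using (Dec; yes; no)
open import Relation.Binary.PropositionalEquality using (_≡_)
open import Data.Bool.Properties using (T?)
open import Data.Bool.Base using (T)

F : ℕ → ℕ
F zero = 0
F (suc zero) = 1
F (suc (suc n)) = F (suc n) + F n

oddᵇ : ℕ → Bool
oddᵇ x = (x % 2) ≡ᵇ 1

-- no two consecutive ones in the binary expansion (fuel-bounded; fuel x suffices)
noConsecAux : ℕ → ℕ → Bool
noConsecAux zero _ = true
noConsecAux (suc f) x = not (oddᵇ x ∧ oddᵇ ⌊ x /2⌋) ∧ noConsecAux f ⌊ x /2⌋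

isFibbinary : ℕ → Bool
isFibbinary x = noConsecAux x x

isOddFibbinary : ℕ → Bool
isOddFibbinary x = oddᵇ x ∧ isFibbinary x

-- inverse of the fibbinary function: bit i (weight 2^i) of x contributes F (i+2).
-- On a fibbinary number x = Σ 2^(i_t - 2) this returns Σ F i_t, i.e. fib⁻¹ x.
fibInvAux : ℕ → ℕ → ℕ → ℕ
fibInvAux zero _ _ = 0
fibInvAux (suc f) i x =
  (if oddᵇ x then F (suc (suc i)) else 0) + fibInvAux f (suc i) ⌊ x /2⌋

fibInv : ℕ → ℕ
fibInv x = fibInvAux x 0 x

-- odd fibbinary numbers in increasing order up to a bound
-- (4^n + 2 bound: 1, 5, 17, ..., 4^(n-1)+1 are n odd fibbinary numbers below it)
oddFibbinariesBelow : ℕ → List ℕ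
oddFibbinariesBelow b = filter (λ x → T? (isOddFibbinary x)) (upTo b)

nth : List ℕ → ℕ → ℕ
nth L.[] _ = 0
nth (x L.∷ xs) zero = x
nth (x L.∷ xs) (suc k) = nth xs k

odfib : ℕ → ℕ
odfib n = nth (oddFibbinariesBelow (4 ^ n + 2)) (n ∸ 1)

Z : ℕ → ℕ
Z n = fibInv (odfib n)

-- Floors involving φ = (1+√5)/2, characterised exactly by integer arithmetic.
-- For k,n ∈ ℕ:  k ≤ nφ  ⇔  2k - n ≤ n√5  ⇔  (2k ∸ n)² ≤ 5n²   (lhs 0 if 2k ≤ n).
-- IsFloorNPhi n k  ⇔  k ≤ nφ < k+1  ⇔  k = ⌊nφ⌋.
IsFloorNPhi : ℕ → ℕ → Set
IsFloorNPhi n k = ((2 * k ∸ n) ^ 2 ≤ 5 * n ^ 2) × (5 * n ^ 2 < (2 * suc k ∸ n) ^ 2)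

-- nφ² = n(3+√5)/2 :  k ≤ nφ²  ⇔  (2k ∸ 3n)² ≤ 5n².
IsFloorNPhi² : ℕ → ℕ → Set
IsFloorNPhi² n k = ((2 * k ∸ 3 * n) ^ 2 ≤ 5 * n ^ 2) × (5 * n ^ 2 < (2 * suc k ∸ 3 * n) ^ 2)

{-# OPTIONS --safe #-}
-- Let C y count the fibbinary numbers below y, and let S y be fib⁻¹ y with every Zeckendorf index
-- raised by one.  Both C and fib⁻¹ satisfy f (4q) = f (2q) + f q and go up by one from one fibbinary
-- number to the next within 4q, 4q + 1, 4q + 2, so C y = fib⁻¹ y for fibbinary y.  The odd fibbinary
-- numbers are the 4y + 1 with y fibbinary, hence odfib n = 4y + 1 for the fibbinary y with
-- C y = n − 1, and Z n = fib⁻¹ (4y + 1) = 1 + S y + fib⁻¹ y = S y + n.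
-- Finally ⌊(fib⁻¹ y + 1) φ⌋ = S y + 1, by induction along the binary digits of y: appending 0 maps
-- (N, B) = (fib⁻¹ y + 1, S y + 1) to (B, B + N − 1), appending 01 maps it to (B + N, 2B + N), and
-- both maps preserve B = ⌊Nφ⌋ because φ² = φ + 1.  So Z n = ⌊nφ⌋ + n − 1, and ⌊nφ²⌋ = ⌊nφ⌋ + n.
module Submission where

open import Defs
open import Data.Bool.Base using (Bool; true; false; not; _∧_; if_then_else_)
open import Data.List.Base using ([]; _∷_; [_]; _++_; length; filterᵇ; upTo)
open import Data.List.Properties using (filter-++; upTo-∷ʳ; length-++)
open import Data.Nat.Base using (ℕ; zero; suc; _+_; _*_; _∸_; _^_; _≤_; _<_; z≤n; s≤s; z<s; ⌊_/2⌋)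
open import Data.Nat.Properties
open import Algebra.Properties.CommutativeSemigroup +-commutativeSemigroup using (interchange)
open import Data.Nat.Induction using (<-rec)
open import Data.Nat.Tactic.RingSolver using (solve-∀)
open import Data.Product.Base using (_×_; _,_; ∃; ∃₂)
open import Data.Sum.Base using (inj₁; inj₂)
open import Function.Base using (_∘_)
open import Relation.Binary.PropositionalEquality hiding ([_])
open import Relation.Nullary using (yes; no; contradiction)
open import Relation.Nullary.Decidable.Core using (T?)

oddᵇ-2* : ∀ k → oddᵇ (2 * k) ≡ false
oddᵇ-2* zero = refl
oddᵇ-2* (suc k) = trans (cong oddᵇ (*-suc 2 k)) (oddᵇ-2* k)

oddᵇ-1+2* : ∀ k → oddᵇ (1 + 2 * k) ≡ true
oddᵇ-1+2* zero = refl
oddᵇ-1+2* (suc k) = trans (cong (oddᵇ ∘ suc) (*-suc 2 k)) (oddᵇ-1+2* k)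

⌊2*/2⌋ : ∀ k → ⌊ 2 * k /2⌋ ≡ k
⌊2*/2⌋ zero = refl
⌊2*/2⌋ (suc k) = trans (cong ⌊_/2⌋ (*-suc 2 k)) (cong suc (⌊2*/2⌋ k))

⌊1+2*/2⌋ : ∀ k → ⌊ 1 + 2 * k /2⌋ ≡ k
⌊1+2*/2⌋ zero = refl
⌊1+2*/2⌋ (suc k) = trans (cong (⌊_/2⌋ ∘ suc) (*-suc 2 k)) (cong suc (⌊1+2*/2⌋ k))

data Parity : ℕ → Set where
  even : ∀ k → Parity (2 * k)
  odd  : ∀ k → Parity (1 + 2 * k)

parity : ∀ n → Parity n
parity zero = even 0
parity (suc n) with parity n
... | even k = odd k
... | odd k = subst Parity (*-suc 2 k) (even (suc k))

noConsecAux-0 : ∀ f → noConsecAux f 0 ≡ true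
noConsecAux-0 zero = refl
noConsecAux-0 (suc f) = noConsecAux-0 f

noConsecAux-fuel : ∀ {f g} x → x ≤ f → x ≤ g → noConsecAux f x ≡ noConsecAux g x
noConsecAux-fuel {f} {g} zero _ _ = trans (noConsecAux-0 f) (sym (noConsecAux-0 g))
noConsecAux-fuel {suc f} {suc g} (suc x) (s≤s x≤f) (s≤s x≤g) =
  cong (not (oddᵇ (suc x) ∧ oddᵇ ⌊ suc x /2⌋) ∧_)
       (noConsecAux-fuel _ (≤-trans ⌊1+x/2⌋≤x x≤f) (≤-trans ⌊1+x/2⌋≤x x≤g))
  where
  ⌊1+x/2⌋≤x : ⌊ suc x /2⌋ ≤ x
  ⌊1+x/2⌋≤x = ≤-pred (⌊n/2⌋<n x)

isFibbinary-step : ∀ x → isFibbinary x ≡ not (oddᵇ x ∧ oddᵇ ⌊ x /2⌋) ∧ isFibbinary ⌊ x /2⌋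
isFibbinary-step zero = refl
isFibbinary-step (suc x) =
  cong (not (oddᵇ (suc x) ∧ oddᵇ ⌊ suc x /2⌋) ∧_) (noConsecAux-fuel _ (≤-pred (⌊n/2⌋<n x)) ≤-refl)

isFibbinary-2* : ∀ k → isFibbinary (2 * k) ≡ isFibbinary k
isFibbinary-2* k = trans (isFibbinary-step (2 * k))
  (cong₂ (λ b h → not (b ∧ oddᵇ h) ∧ isFibbinary h) (oddᵇ-2* k) (⌊2*/2⌋ k))

isFibbinary-1+2* : ∀ k → isFibbinary (1 + 2 * k) ≡ not (oddᵇ k) ∧ isFibbinary k
isFibbinary-1+2* k = trans (isFibbinary-step (1 + 2 * k))
  (cong₂ (λ b h → not (b ∧ oddᵇ h) ∧ isFibbinary h) (oddᵇ-1+2* k) (⌊1+2*/2⌋ k))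

isFibbinary-2*[2*] : ∀ q → isFibbinary (2 * (2 * q)) ≡ isFibbinary q
isFibbinary-2*[2*] q = trans (isFibbinary-2* (2 * q)) (isFibbinary-2* q)

isFibbinary-1+2*[2*] : ∀ q → isFibbinary (1 + 2 * (2 * q)) ≡ isFibbinary q
isFibbinary-1+2*[2*] q = trans (isFibbinary-1+2* (2 * q))
  (cong₂ (λ b c → not b ∧ c) (oddᵇ-2* q) (isFibbinary-2* q))

isFibbinary-1+2*[1+2*] : ∀ q → isFibbinary (1 + 2 * (1 + 2 * q)) ≡ false
isFibbinary-1+2*[1+2*] q = trans (isFibbinary-1+2* (1 + 2 * q))
  (cong (λ b → not b ∧ isFibbinary (1 + 2 * q)) (oddᵇ-1+2* q))

isOddFibbinary-2* : ∀ k → isOddFibbinary (2 * k) ≡ false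
isOddFibbinary-2* k = cong (_∧ isFibbinary (2 * k)) (oddᵇ-2* k)

isOddFibbinary-1+2*[2*] : ∀ q → isOddFibbinary (1 + 2 * (2 * q)) ≡ isFibbinary q
isOddFibbinary-1+2*[2*] q = cong₂ _∧_ (oddᵇ-1+2* (2 * q)) (isFibbinary-1+2*[2*] q)

-- Bit j of x contributes F (j + i + 2): fibInv with every Zeckendorf index raised by i.
fibInvShift : ℕ → ℕ → ℕ
fibInvShift i x = fibInvAux x i x

fibInvAux-0 : ∀ f i → fibInvAux f i 0 ≡ 0
fibInvAux-0 zero i = refl
fibInvAux-0 (suc f) i = fibInvAux-0 f (suc i)

fibInvAux-fuel : ∀ {f g} i x → x ≤ f → x ≤ g → fibInvAux f i x ≡ fibInvAux g i x
fibInvAux-fuel {f} {g} i zero _ _ = trans (fibInvAux-0 f i) (sym (fibInvAux-0 g i))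
fibInvAux-fuel {suc f} {suc g} i (suc x) (s≤s x≤f) (s≤s x≤g) =
  cong ((if oddᵇ (suc x) then F (2 + i) else 0) +_)
       (fibInvAux-fuel (suc i) _ (≤-trans ⌊1+x/2⌋≤x x≤f) (≤-trans ⌊1+x/2⌋≤x x≤g))
  where
  ⌊1+x/2⌋≤x : ⌊ suc x /2⌋ ≤ x
  ⌊1+x/2⌋≤x = ≤-pred (⌊n/2⌋<n x)

fibInvShift-step : ∀ i x →
  fibInvShift i x ≡ (if oddᵇ x then F (2 + i) else 0) + fibInvShift (suc i) ⌊ x /2⌋
fibInvShift-step i zero = refl
fibInvShift-step i (suc x) =
  cong ((if oddᵇ (suc x) then F (2 + i) else 0) +_)
       (fibInvAux-fuel (suc i) _ (≤-pred (⌊n/2⌋<n x)) ≤-refl)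

fibInvShift-2* : ∀ i k → fibInvShift i (2 * k) ≡ fibInvShift (suc i) k
fibInvShift-2* i k = trans (fibInvShift-step i (2 * k))
  (cong₂ (λ b h → (if b then F (2 + i) else 0) + fibInvShift (suc i) h) (oddᵇ-2* k) (⌊2*/2⌋ k))

fibInvShift-1+2* : ∀ i k → fibInvShift i (1 + 2 * k) ≡ F (2 + i) + fibInvShift (suc i) k
fibInvShift-1+2* i k = trans (fibInvShift-step i (1 + 2 * k))
  (cong₂ (λ b h → (if b then F (2 + i) else 0) + fibInvShift (suc i) h) (oddᵇ-1+2* k) (⌊1+2*/2⌋ k))

fibInvAux-fib : ∀ f i x → fibInvAux f (2 + i) x ≡ fibInvAux f (1 + i) x + fibInvAux f i x
fibInvAux-fib zero i x = refl
fibInvAux-fib (suc f) i x with oddᵇ x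
... | true  = trans (cong (F (3 + i) + F (2 + i) +_) (fibInvAux-fib f (suc i) ⌊ x /2⌋))
                    (interchange (F (3 + i)) (F (2 + i)) _ _)
... | false = fibInvAux-fib f (suc i) ⌊ x /2⌋

fibInvShift-fib : ∀ i x → fibInvShift (2 + i) x ≡ fibInvShift (1 + i) x + fibInvShift i x
fibInvShift-fib i x = fibInvAux-fib x i x

fibInv-2*[2*] : ∀ q → fibInv (2 * (2 * q)) ≡ fibInvShift 2 q
fibInv-2*[2*] q = trans (fibInvShift-2* 0 (2 * q)) (fibInvShift-2* 1 q)

fibInv-1+2* : ∀ k → fibInv (1 + 2 * k) ≡ 1 + fibInv (2 * k)
fibInv-1+2* k = trans (fibInvShift-1+2* 0 k) (cong suc (sym (fibInvShift-2* 0 k)))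

fibInv-2*[1+2*] : ∀ q → fibInv (2 * (1 + 2 * q)) ≡ 2 + fibInv (2 * (2 * q))
fibInv-2*[1+2*] q = begin
  fibInv (2 * (1 + 2 * q))   ≡⟨ fibInvShift-2* 0 (1 + 2 * q) ⟩
  fibInvShift 1 (1 + 2 * q)  ≡⟨ fibInvShift-1+2* 1 q ⟩
  2 + fibInvShift 2 q        ≡⟨ cong (2 +_) (fibInv-2*[2*] q) ⟨
  2 + fibInv (2 * (2 * q))   ∎
  where open ≡-Reasoning

toℕ : Bool → ℕ
toℕ false = 0
toℕ true = 1

count : (ℕ → Bool) → ℕ → ℕ
count p zero = 0
count p (suc n) = toℕ (p n) + count p n

infixr 5 _⟨+⟩_
_⟨+⟩_ : ∀ {a b m n} → a ≡ b → m ≡ n → toℕ a + m ≡ toℕ b + n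
_⟨+⟩_ = cong₂ (λ b n → toℕ b + n)

count-suc-true : ∀ p {n} → p n ≡ true → count p (suc n) ≡ suc (count p n)
count-suc-true p pn = pn ⟨+⟩ refl

count-mono : ∀ p {m n} → m ≤ n → count p m ≤ count p n
count-mono p {n = zero} z≤n = ≤-refl
count-mono p {n = suc n} m≤1+n with m≤n⇒m<n∨m≡n m≤1+n
... | inj₁ m<1+n = ≤-trans (count-mono p (≤-pred m<1+n)) (m≤n+m (count p n) (toℕ (p n)))
... | inj₂ refl = ≤-refl

count-attains : ∀ p x k → k < count p x → ∃ λ y → y < x × p y ≡ true × count p y ≡ k
count-attains p (suc x) k k<count with p x in px | k <? count p x
... | _     | yes k<cx with count-attains p x k k<cx
...   | y , y<x , py , cy = y , m<n⇒m<1+n y<x , py , cy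
count-attains p (suc x) k k<count | true  | no k≮cx = x , ≤-refl , px , ≤-antisym (≮⇒≥ k≮cx) (≤-pred k<count)
count-attains p (suc x) k k<count | false | no k≮cx = contradiction k<count k≮cx

count-2*-suc : ∀ p k → count p (2 * suc k) ≡ toℕ (p (1 + 2 * k)) + (toℕ (p (2 * k)) + count p (2 * k))
count-2*-suc p k = cong (count p) (*-suc 2 k)

count-2*[2*[1+q]] : ∀ p q → count p (2 * (2 * suc q)) ≡
  toℕ (p (1 + 2 * (1 + 2 * q))) + (toℕ (p (2 * (1 + 2 * q))) +
  (toℕ (p (1 + 2 * (2 * q))) + (toℕ (p (2 * (2 * q))) + count p (2 * (2 * q)))))
count-2*[2*[1+q]] p q = begin
  count p (2 * (2 * suc q))      ≡⟨ cong (count p ∘ (2 *_)) (*-suc 2 q) ⟩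
  count p (2 * suc (1 + 2 * q))  ≡⟨ count-2*-suc p (1 + 2 * q) ⟩
  _                              ≡⟨ cong (λ m → toℕ (p (1 + 2 * (1 + 2 * q))) + (toℕ (p (2 * (1 + 2 * q))) + m))
                                          (count-2*-suc p (2 * q)) ⟩
  _                              ∎
  where open ≡-Reasoning

-- A fibbinary number below 4q is 2z with z < 2q fibbinary, or 4z + 1 with z < q fibbinary.
countFibbinary-2*[2*] : ∀ q → count isFibbinary (2 * (2 * q)) ≡ count isFibbinary (2 * q) + count isFibbinary q
countFibbinary-2*[2*] zero = refl
countFibbinary-2*[2*] (suc q) = begin
  C (2 * (2 * suc q))                                      ≡⟨ count-2*[2*[1+q]] isFibbinary q ⟩
  _                                                        ≡⟨ isFibbinary-1+2*[1+2*] q ⟨+⟩ isFibbinary-2* (1 + 2 * q)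
                                                              ⟨+⟩ isFibbinary-1+2*[2*] q ⟨+⟩ isFibbinary-2*[2*] q
                                                              ⟨+⟩ countFibbinary-2*[2*] q ⟩
  0 + (t (1 + 2 * q) + (t q + (t q + (C (2 * q) + C q))))  ≡⟨ rearrange (t (1 + 2 * q)) (t q) (C (2 * q)) (C q) ⟩
  (t (1 + 2 * q) + (t q + C (2 * q))) + (t q + C q)        ≡⟨ cong (λ b → t (1 + 2 * q) + (toℕ b + C (2 * q)) + (t q + C q))
                                                                   (isFibbinary-2* q) ⟨
  (t (1 + 2 * q) + (t (2 * q) + C (2 * q))) + C (suc q)    ≡⟨ cong (_+ C (suc q)) (count-2*-suc isFibbinary q) ⟨
  C (2 * suc q) + C (suc q)                                ∎
  where
  open ≡-Reasoning
  C t : ℕ → ℕ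
  C = count isFibbinary
  t n = toℕ (isFibbinary n)
  rearrange : ∀ a b c d → 0 + (a + (b + (b + (c + d)))) ≡ (a + (b + c)) + (b + d)
  rearrange = solve-∀

countOddFibbinary-2*[2*] : ∀ q → count isOddFibbinary (2 * (2 * q)) ≡ count isFibbinary q
countOddFibbinary-2*[2*] zero = refl
countOddFibbinary-2*[2*] (suc q) = trans (count-2*[2*[1+q]] isOddFibbinary q)
  (cong₂ _∧_ (oddᵇ-1+2* (1 + 2 * q)) (isFibbinary-1+2*[1+2*] q) ⟨+⟩ isOddFibbinary-2* (1 + 2 * q)
   ⟨+⟩ isOddFibbinary-1+2*[2*] q ⟨+⟩ isOddFibbinary-2* (2 * q)
   ⟨+⟩ countOddFibbinary-2*[2*] q)

∧≡true⇒ʳ : ∀ a {b} → a ∧ b ≡ true → b ≡ true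
∧≡true⇒ʳ true b≡true = b≡true

countFibbinary≡fibInv : ∀ y → isFibbinary y ≡ true → count isFibbinary y ≡ fibInv y
countFibbinary≡fibInv = <-rec _ go
  where
  C : ℕ → ℕ
  C = count isFibbinary
  go : ∀ y → (∀ {z} → z < y → isFibbinary z ≡ true → C z ≡ fibInv z) → isFibbinary y ≡ true → C y ≡ fibInv y
  go y ih fy with parity y
  ... | even k with parity k
  ...   | even zero = refl
  ...   | even q@(suc _) = begin
    C (2 * (2 * q))                        ≡⟨ countFibbinary-2*[2*] q ⟩
    C (2 * q) + C q                        ≡⟨ cong₂ _+_ (ih 2q<4q f2q) (ih (<-trans q<2q 2q<4q) fq) ⟩
    fibInv (2 * q) + fibInv q              ≡⟨ cong (_+ fibInv q) (fibInvShift-2* 0 q) ⟩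
    fibInvShift 1 q + fibInvShift 0 q      ≡⟨ fibInvShift-fib 0 q ⟨
    fibInvShift 2 q                        ≡⟨ fibInv-2*[2*] q ⟨
    fibInv (2 * (2 * q))                   ∎
    where
    open ≡-Reasoning
    q<2q : q < 2 * q
    q<2q = m<m+n q z<s
    2q<4q : 2 * q < 2 * (2 * q)
    2q<4q = m<m+n (2 * q) z<s
    f2q : isFibbinary (2 * q) ≡ true
    f2q = trans (sym (isFibbinary-2* (2 * q))) fy
    fq : isFibbinary q ≡ true
    fq = trans (sym (isFibbinary-2* q)) f2q
  ...   | odd q = begin
    C (2 * (1 + 2 * q))                    ≡⟨ count-2*-suc isFibbinary (2 * q) ⟩
    _                                      ≡⟨ trans (isFibbinary-1+2*[2*] q) fq ⟨+⟩ trans (isFibbinary-2*[2*] q) fq ⟨+⟩ refl ⟩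
    2 + C (2 * (2 * q))                    ≡⟨ cong (2 +_) (ih (*-monoʳ-< 2 (n<1+n (2 * q))) (trans (isFibbinary-2*[2*] q) fq)) ⟩
    2 + fibInv (2 * (2 * q))               ≡⟨ fibInv-2*[1+2*] q ⟨
    fibInv (2 * (1 + 2 * q))               ∎
    where
    open ≡-Reasoning
    fq : isFibbinary q ≡ true
    fq = ∧≡true⇒ʳ (not (oddᵇ q)) (trans (sym (isFibbinary-1+2* q)) (trans (sym (isFibbinary-2* (1 + 2 * q))) fy))
  go y ih fy | odd k with parity k
  ...   | even q = begin
    C (1 + 2 * (2 * q))                    ≡⟨ count-suc-true isFibbinary {2 * (2 * q)} (trans (isFibbinary-2*[2*] q) fq) ⟩
    1 + C (2 * (2 * q))                    ≡⟨ cong suc (ih (n<1+n _) (trans (isFibbinary-2*[2*] q) fq)) ⟩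
    1 + fibInv (2 * (2 * q))               ≡⟨ fibInv-1+2* (2 * q) ⟨
    fibInv (1 + 2 * (2 * q))               ∎
    where
    open ≡-Reasoning
    fq : isFibbinary q ≡ true
    fq = trans (sym (isFibbinary-1+2*[2*] q)) fy
  ...   | odd q = contradiction (trans (sym (isFibbinary-1+2*[1+2*] q)) fy) λ ()

countFibbinary-4^ : ∀ j → j < count isFibbinary (4 ^ j)
countFibbinary-4^ zero = z<s
countFibbinary-4^ (suc j) = begin
  suc (suc j)                    ≤⟨ +-mono-≤ 1≤C[2*4^j] (countFibbinary-4^ j) ⟩
  C (2 * 4 ^ j) + C (4 ^ j)      ≡⟨ countFibbinary-2*[2*] (4 ^ j) ⟨
  C (2 * (2 * 4 ^ j))            ≡⟨ cong C (*-assoc 2 2 (4 ^ j)) ⟨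
  C (4 ^ suc j)                  ∎
  where
  open ≤-Reasoning
  C : ℕ → ℕ
  C = count isFibbinary
  1≤C[2*4^j] : 1 ≤ C (2 * 4 ^ j)
  1≤C[2*4^j] = ≤-trans (≤-trans (s≤s z≤n) (countFibbinary-4^ j)) (count-mono isFibbinary (m≤m+n (4 ^ j) _))

nth-++ˡ : ∀ xs {ys k} → k < length xs → nth (xs ++ ys) k ≡ nth xs k
nth-++ˡ (x ∷ xs) {k = zero} _ = refl
nth-++ˡ (x ∷ xs) {k = suc k} (s≤s k<n) = nth-++ˡ xs k<n

nth-++-length : ∀ xs {y ys} → nth (xs ++ y ∷ ys) (length xs) ≡ y
nth-++-length [] = refl
nth-++-length (x ∷ xs) = nth-++-length xs

filterᵇ-upTo-suc : ∀ p n → filterᵇ p (upTo (suc n)) ≡ filterᵇ p (upTo n) ++ filterᵇ p [ n ]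
filterᵇ-upTo-suc p n = trans (cong (filterᵇ p) (sym (upTo-∷ʳ n))) (filter-++ (T? ∘ p) (upTo n) [ n ])

length-filterᵇ-[x] : ∀ (p : ℕ → Bool) n → length (filterᵇ p [ n ]) ≡ toℕ (p n)
length-filterᵇ-[x] p n with p n
... | true = refl
... | false = refl

filterᵇ-[x] : ∀ (p : ℕ → Bool) {n} → p n ≡ true → filterᵇ p [ n ] ≡ [ n ]
filterᵇ-[x] p {n} pn with p n
filterᵇ-[x] p refl | true = refl

length-filterᵇ-upTo : ∀ p n → length (filterᵇ p (upTo n)) ≡ count p n
length-filterᵇ-upTo p zero = refl
length-filterᵇ-upTo p (suc n) = begin
  length (filterᵇ p (upTo (suc n)))                        ≡⟨ cong length (filterᵇ-upTo-suc p n) ⟩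
  length (filterᵇ p (upTo n) ++ filterᵇ p [ n ])           ≡⟨ length-++ (filterᵇ p (upTo n)) ⟩
  length (filterᵇ p (upTo n)) + length (filterᵇ p [ n ])  ≡⟨ cong₂ _+_ (length-filterᵇ-upTo p n) (length-filterᵇ-[x] p n) ⟩
  count p n + toℕ (p n)                                    ≡⟨ +-comm (count p n) (toℕ (p n)) ⟩
  count p (suc n)                                          ∎
  where open ≡-Reasoning

nth-filterᵇ-upTo : ∀ p {x} b → p x ≡ true → x < b → nth (filterᵇ p (upTo b)) (count p x) ≡ x
nth-filterᵇ-upTo p {x} (suc b) px x<1+b with m≤n⇒m<n∨m≡n (≤-pred x<1+b)
... | inj₁ x<b = begin
  nth (filterᵇ p (upTo (suc b))) (count p x)                     ≡⟨ cong (λ xs → nth xs (count p x)) (filterᵇ-upTo-suc p b) ⟩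
  nth (filterᵇ p (upTo b) ++ filterᵇ p [ b ]) (count p x)        ≡⟨ nth-++ˡ (filterᵇ p (upTo b)) count<length ⟩
  nth (filterᵇ p (upTo b)) (count p x)                           ≡⟨ nth-filterᵇ-upTo p b px x<b ⟩
  x                                                               ∎
  where
  open ≡-Reasoning
  count<length : count p x < length (filterᵇ p (upTo b))
  count<length = subst (count p x <_) (sym (length-filterᵇ-upTo p b))
                       (≤-trans (≤-reflexive (sym (count-suc-true p px))) (count-mono p x<b))
... | inj₂ refl = begin
  nth (filterᵇ p (upTo (suc x))) (count p x)                     ≡⟨ cong (λ xs → nth xs (count p x)) (filterᵇ-upTo-suc p x) ⟩
  nth (filterᵇ p (upTo x) ++ filterᵇ p [ x ]) (count p x)        ≡⟨ cong (λ xs → nth (filterᵇ p (upTo x) ++ xs) (count p x)) (filterᵇ-[x] p px) ⟩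
  nth (filterᵇ p (upTo x) ++ [ x ]) (count p x)                  ≡⟨ cong (nth (filterᵇ p (upTo x) ++ [ x ])) (length-filterᵇ-upTo p x) ⟨
  nth (filterᵇ p (upTo x) ++ [ x ]) (length (filterᵇ p (upTo x)))  ≡⟨ nth-++-length (filterᵇ p (upTo x)) ⟩
  x                                                               ∎
  where open ≡-Reasoning

odfib-suc : ∀ {k y} → isFibbinary y ≡ true → y < 4 ^ k → count isFibbinary y ≡ k →
            odfib (suc k) ≡ 1 + 2 * (2 * y)
odfib-suc {k} {y} fy y<4^k count≡k =
  subst (λ i → nth (filterᵇ isOddFibbinary (upTo (4 ^ suc k + 2))) i ≡ x) countOdd≡k
        (nth-filterᵇ-upTo isOddFibbinary (4 ^ suc k + 2) (trans (isOddFibbinary-1+2*[2*] y) fy) x<bound)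
  where
  x : ℕ
  x = 1 + 2 * (2 * y)
  countOdd≡k : count isOddFibbinary x ≡ k
  countOdd≡k = trans (isOddFibbinary-2* (2 * y) ⟨+⟩ countOddFibbinary-2*[2*] y) count≡k
  x<bound : x < 4 ^ suc k + 2
  x<bound = begin-strict
    1 + 2 * (2 * y)  ≡⟨ cong suc (*-assoc 2 2 y) ⟨
    1 + 4 * y        <⟨ +-monoˡ-< (4 * y) {1} {4} (s≤s (s≤s z≤n)) ⟩
    4 + 4 * y        ≡⟨ *-suc 4 y ⟨
    4 * suc y        ≤⟨ *-monoʳ-≤ 4 y<4^k ⟩
    4 ^ suc k        ≤⟨ m≤m+n (4 ^ suc k) 2 ⟩
    4 ^ suc k + 2    ∎
    where open ≤-Reasoning

-- B < Nφ < B + 1, as x < φ ⇔ x² < x + 1 for x ≥ 0.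
record FloorMulφ (N B : ℕ) : Set where
  constructor floorMulφ
  field
    lower : B * B < B * N + N * N
    upper : suc B * N + N * N < suc B * suc B

-- v − u = (y − x) + e, stated without truncated subtraction.
<-from-gap : ∀ {x y u v} e → y + u + e ≡ v + x → x < y → u < v
<-from-gap {x} {y} {u} {v} e eq x<y = +-cancelˡ-< y u v (begin-strict
  y + u      ≤⟨ m≤m+n (y + u) e ⟩
  y + u + e  ≡⟨ eq ⟩
  v + x      <⟨ +-monoʳ-< v x<y ⟩
  v + y      ≡⟨ +-comm v y ⟩
  y + v      ∎)
  where open ≤-Reasoning

floorMulφ-1 : FloorMulφ 1 1
floorMulφ-1 = floorMulφ (s≤s (s≤s z≤n)) (s≤s (s≤s (s≤s (s≤s z≤n))))

floorMulφ⇒≤ : ∀ {N B} → FloorMulφ N B → N ≤ B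
floorMulφ⇒≤ {N} {B} (floorMulφ _ upper) =
  ≤-pred (*-cancelˡ-< (suc B) N (suc B) (≤-<-trans (m≤m+n (suc B * N) (N * N)) upper))

floorMulφ⇒<2* : ∀ {N B} → FloorMulφ N B → B < N + N
floorMulφ⇒<2* {N} {B} fl@(floorMulφ lower _) = *-cancelˡ-< B B (N + N) (begin-strict
  B * B          <⟨ lower ⟩
  B * N + N * N  ≤⟨ +-monoʳ-≤ (B * N) (*-monoˡ-≤ N (floorMulφ⇒≤ fl)) ⟩
  B * N + B * N  ≡⟨ *-distribˡ-+ B N N ⟨
  B * (N + N)    ∎)
  where open ≤-Reasoning

floorMulφ-at-floor : ∀ {m B} → FloorMulφ (suc m) B → FloorMulφ B (B + m)
floorMulφ-at-floor {m} {B} fl@(floorMulφ lower upper) =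
  floorMulφ (<-from-gap 0 (new-lower m B) (+-mono-<-≤ upper B+2≤3N)) (<-from-gap 0 (new-upper m B) lower)
  where
  N : ℕ
  N = suc m
  B+2≤3N : suc B + 1 ≤ N + N + N
  B+2≤3N = +-mono-≤ (floorMulφ⇒<2* fl) (s≤s z≤n)
  new-lower : ∀ m B → suc B * suc B + (suc m + suc m + suc m) + (B + m) * (B + m) + 0
                    ≡ (B + m) * B + B * B + (suc B * suc m + suc m * suc m + (suc B + 1))
  new-lower = solve-∀
  new-upper : ∀ m B → B * suc m + suc m * suc m + (suc (B + m) * B + B * B) + 0
                    ≡ suc (B + m) * suc (B + m) + B * B
  new-upper = solve-∀

floorMulφ-at-sum : ∀ {N B} → FloorMulφ N B → FloorMulφ (B + N) (B + B + N)
floorMulφ-at-sum {N} {B} (floorMulφ lower upper) =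
  floorMulφ (<-from-gap 0 (new-lower N B) lower) (<-from-gap (B + N + N) (new-upper N B) upper)
  where
  new-lower : ∀ N B → B * N + N * N + (B + B + N) * (B + B + N) + 0
                    ≡ (B + B + N) * (B + N) + (B + N) * (B + N) + B * B
  new-lower = solve-∀
  new-upper : ∀ N B → suc B * suc B + (suc (B + B + N) * (B + N) + (B + N) * (B + N)) + (B + N + N)
                    ≡ suc (B + B + N) * suc (B + B + N) + (suc B * N + N * N)
  new-upper = solve-∀

-- With 2B = d + N, four times B² ≶ BN + N² reads d² + c ≶ 5N² + c.
4*-as-squares : ∀ {N} B → N ≤ 2 * B → let d = 2 * B ∸ N; c = 2 * d * N + N * N in
  (4 * (B * B) ≡ d ^ 2 + c) × (4 * (B * N + N * N) ≡ 5 * N ^ 2 + c)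
4*-as-squares {N} B N≤2B =
  trans (4B² B) (trans (cong (λ t → t * t) (sym d+N≡2B)) (square d N)) ,
  trans (4[BN+N²] B N) (trans (cong (λ t → 2 * t * N + 4 * (N * N)) (sym d+N≡2B)) (cross d N))
  where
  d : ℕ
  d = 2 * B ∸ N
  d+N≡2B : d + N ≡ 2 * B
  d+N≡2B = m∸n+n≡m N≤2B
  4B² : ∀ b → 4 * (b * b) ≡ 2 * b * (2 * b)
  4B² = solve-∀
  4[BN+N²] : ∀ b n → 4 * (b * n + n * n) ≡ 2 * (2 * b) * n + 4 * (n * n)
  4[BN+N²] = solve-∀
  square : ∀ x n → (x + n) * (x + n) ≡ x * (x * 1) + (2 * x * n + n * n)
  square = solve-∀
  cross : ∀ x n → 2 * (x + n) * n + 4 * (n * n) ≡ 5 * (n * (n * 1)) + (2 * x * n + n * n)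
  cross = solve-∀

floorMulφ⇒isFloorNPhi : ∀ {N B} → FloorMulφ N B → IsFloorNPhi N B
floorMulφ⇒isFloorNPhi {N} {B} fl@(floorMulφ lower upper) = below , above
  where
  below : (2 * B ∸ N) ^ 2 ≤ 5 * N ^ 2
  below with N ≤? 2 * B
  ... | no N≰2B = subst (λ d → d ^ 2 ≤ 5 * N ^ 2) (sym (m≤n⇒m∸n≡0 (≰⇒≥ N≰2B))) z≤n
  ... | yes N≤2B with 4*-as-squares B N≤2B
  ...   | eqB , eqN = <⇒≤ (+-cancelʳ-< _ _ _ (subst₂ _<_ eqB eqN (*-monoʳ-< 4 lower)))
  above : 5 * N ^ 2 < (2 * suc B ∸ N) ^ 2
  above with 4*-as-squares (suc B) (≤-trans (floorMulφ⇒≤ fl) (≤-trans (n≤1+n B) (m≤m+n (suc B) _)))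
  ... | eqB , eqN = +-cancelʳ-< _ _ _ (subst₂ _<_ eqN eqB (*-monoʳ-< 4 upper))

isFloorNPhi⇒isFloorNPhi² : ∀ {N B} → IsFloorNPhi N B → IsFloorNPhi² N (B + N)
isFloorNPhi⇒isFloorNPhi² {N} {B} (below , above) =
  subst (λ d → d ^ 2 ≤ 5 * N ^ 2) (sym (2*[B+N]∸3*N B)) below ,
  subst (λ d → 5 * N ^ 2 < d ^ 2) (sym (2*[B+N]∸3*N (suc B))) above
  where
  2*[B+N]∸3*N : ∀ B → 2 * (B + N) ∸ 3 * N ≡ 2 * B ∸ N
  2*[B+N]∸3*N B = trans (cong₂ _∸_ (split₁ B N) (split₂ N)) ([m+n]∸[m+o]≡n∸o (2 * N) (2 * B) N)
    where
    split₁ : ∀ B N → 2 * (B + N) ≡ 2 * N + 2 * B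
    split₁ = solve-∀
    split₂ : ∀ N → 3 * N ≡ 2 * N + N
    split₂ = solve-∀

floorMulφ-fibInv : ∀ y → isFibbinary y ≡ true → FloorMulφ (suc (fibInv y)) (suc (fibInvShift 1 y))
floorMulφ-fibInv = <-rec _ go
  where
  go : ∀ y → (∀ {z} → z < y → isFibbinary z ≡ true → FloorMulφ (suc (fibInv z)) (suc (fibInvShift 1 z)))
         → isFibbinary y ≡ true → FloorMulφ (suc (fibInv y)) (suc (fibInvShift 1 y))
  go y ih fy with parity y
  ... | even zero = floorMulφ-1
  ... | even k@(suc _) =
    subst₂ FloorMulφ (sym (cong suc (fibInvShift-2* 0 k)))
                     (sym (cong suc (trans (fibInvShift-2* 1 k) (fibInvShift-fib 0 k))))
                     (floorMulφ-at-floor (ih (m<m+n k z<s) (trans (sym (isFibbinary-2* k)) fy)))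
  ... | odd k with parity k
  ...   | odd j = contradiction (trans (sym (isFibbinary-1+2*[1+2*] j)) fy) λ ()
  ...   | even w = subst₂ FloorMulφ N≡ B≡ (floorMulφ-at-sum (ih w<y (trans (sym (isFibbinary-1+2*[2*] w)) fy)))
    where
    open ≡-Reasoning
    m s : ℕ
    m = fibInv w
    s = fibInvShift 1 w
    w<y : w < 1 + 2 * (2 * w)
    w<y = s≤s (≤-trans (m≤m+n w _) (m≤m+n (2 * w) _))
    N≡ : suc s + suc m ≡ suc (fibInv (1 + 2 * (2 * w)))
    N≡ = begin
      suc s + suc m                          ≡⟨ cong suc (+-suc s m) ⟩
      2 + (s + m)                            ≡⟨ cong (2 +_) (fibInvShift-fib 0 w) ⟨
      2 + fibInvShift 2 w                    ≡⟨ cong (2 +_) (fibInvShift-2* 1 w) ⟨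
      2 + fibInvShift 1 (2 * w)              ≡⟨ cong suc (fibInvShift-1+2* 0 (2 * w)) ⟨
      suc (fibInv (1 + 2 * (2 * w)))         ∎
    B≡ : suc s + suc s + suc m ≡ suc (fibInvShift 1 (1 + 2 * (2 * w)))
    B≡ = begin
      suc s + suc s + suc m                  ≡⟨ regroup s m ⟩
      3 + ((s + m) + s)                      ≡⟨ cong (λ t → 3 + (t + s)) (fibInvShift-fib 0 w) ⟨
      3 + (fibInvShift 2 w + s)              ≡⟨ cong (3 +_) (fibInvShift-fib 1 w) ⟨
      3 + fibInvShift 3 w                    ≡⟨ cong (3 +_) (fibInvShift-2* 2 w) ⟨
      3 + fibInvShift 2 (2 * w)              ≡⟨ cong suc (fibInvShift-1+2* 1 (2 * w)) ⟨
      suc (fibInvShift 1 (1 + 2 * (2 * w)))  ∎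
      where
      regroup : ∀ s m → suc s + suc s + suc m ≡ 3 + ((s + m) + s)
      regroup = solve-∀

Z-suc : ∀ {k y} → isFibbinary y ≡ true → y < 4 ^ k → count isFibbinary y ≡ k →
        Z (suc k) ≡ fibInvShift 1 y + suc k
Z-suc {k} {y} fy y<4^k count≡k = begin
  fibInv (odfib (suc k))            ≡⟨ cong fibInv (odfib-suc fy y<4^k count≡k) ⟩
  fibInv (1 + 2 * (2 * y))          ≡⟨ fibInv-1+2* (2 * y) ⟩
  1 + fibInv (2 * (2 * y))          ≡⟨ cong suc (trans (fibInv-2*[2*] y) (fibInvShift-fib 0 y)) ⟩
  1 + (fibInvShift 1 y + fibInv y)  ≡⟨ cong (λ m → 1 + (fibInvShift 1 y + m)) (trans (sym (countFibbinary≡fibInv y fy)) count≡k) ⟩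
  1 + (fibInvShift 1 y + k)         ≡⟨ +-suc (fibInvShift 1 y) k ⟨
  fibInvShift 1 y + suc k           ∎
  where open ≡-Reasoning

theorem1 : (n : ℕ) → 1 ≤ n →
    ∃₂ λ a b → IsFloorNPhi² n a × IsFloorNPhi n b × (Z n ≡ a ∸ 1) × (Z n ≡ b + n ∸ 1)
theorem1 zero ()
theorem1 (suc k) _ with count-attains isFibbinary (4 ^ k) k (countFibbinary-4^ k)
... | y , y<4^k , fy , count≡k =
  b + suc k , b , isFloorNPhi⇒isFloorNPhi² {suc k} {b} floor , floor , Z-suc fy y<4^k count≡k , Z-suc fy y<4^k count≡k
  where
  b : ℕ
  b = suc (fibInvShift 1 y)
  floor : IsFloorNPhi (suc k) b
  floor = floorMulφ⇒isFloorNPhi (subst (λ m → FloorMulφ (suc m) b)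
                                       (trans (sym (countFibbinary≡fibInv y fy)) count≡k)
                                       (floorMulφ-fibInv y fy))
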